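{- For infinitely many positive integers $N$ there exists a pair of integers $(a,b)$ with $0<a,b<N$ such that $f(N,a,b)>1$.
   Context: For integers $N\ge1$ and $a,b$, the modular lattice is $L_{N,a,b}=\{(na \bmod N,\ nb \bmod N):0\le n<N\}$, and $\lambda(L_{N,a,b})$ denotes the length of a shortest non-zero vector of the lattice $L((a,b),(N,0),(0,N))$ of all integer linear combinations of $(a,b),(N,0),(0,N)$. Define $f(N,a,b)=\lambda(L_{N,a,b})/\sqrt{N}$. -}

module Defs where

open import Data.Nat using (ℕ)
open import Data.Integer using (ℤ; +_; _+_; _*_; _<_; 0ℤ)
open import Data.Product using (_×_; ∃-syntax)
open import Relation.Binary.PropositionalEquality using (_≡_)
open import Relation.Nullary using (¬_)

InLattice : ℕ → ℤ → ℤ → ℤ → ℤ → Set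
InLattice N a b x y =
  ∃[ k ] ∃[ m ] ∃[ n ] (x ≡ k * a + m * + N) × (y ≡ k * b + n * + N)

normSq : ℤ → ℤ → ℤ
normSq x y = x * x + y * y

-- f(N,a,b) > 1, i.e. λ(L_{N,a,b}) > √N.  Since the lattice is discrete the
-- minimum λ is attained, so this holds iff every non-zero lattice vector
-- v satisfies |v|² > N.
fGreaterOne : ℕ → ℤ → ℤ → Set
fGreaterOne N a b =
  ∀ x y → InLattice N a b x y → ¬ (x ≡ 0ℤ × y ≡ 0ℤ) → + N < normSq x y

-- For s ∈ ℕ put u = 3 + s, T = u + 1 = 4 + s and N = u(u + 2) = T² - 1,
-- and take (a, b) = (T, 1).  Since N = T² - 1, the lattice generated by
-- (T,1), (N,0), (0,N) is already generated by (T,1) and (1,T): every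
-- lattice vector is (iT + j, i + jT) for some integers i, j
-- (latticeCoordinates).  Its squared norm is the quadratic form
--   (iT + j)² + (i + jT)² = u²(i² + j²) + 2T(i + j)²,
-- a polynomial with natural coefficients in |i|², |j|², |i + j|²
-- (normAsNatural).  If one of i, j vanishes the form is (u² + 2T)(i² + j²)
-- ≥ u² + 2u + 2 > N; otherwise i² + j² ≥ 2 and it is ≥ 2u² > N, because
-- u ≥ 3 (formBound, a statement about natural numbers).
module Submission where

open import Defs
open import Data.Nat using (ℕ; _<_; _≤_; suc; zero; s≤s; z≤n)
import Data.Nat as ℕ
import Data.Nat.Properties as ℕP
import Data.Nat.Tactic.RingSolver as ℕSolver
open import Data.Integer using (+_; -[1+_]; 0ℤ; 1ℤ; _+_; _*_; _-_; ∣_∣)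
import Data.Integer as ℤ
import Data.Integer.Properties as ℤP
open import Data.Integer.Tactic.RingSolver using (solve-∀)
open import Data.Product using (_×_; ∃-syntax; _,_)
open import Relation.Binary.PropositionalEquality
open import Relation.Nullary using (¬_; contradiction)

open ≡-Reasoning

latticeCoordinates : ∀ {N T x y} → + N ≡ T * T - 1ℤ → InLattice N T 1ℤ x y →
  ∃[ i ] ∃[ j ] (x ≡ i * T + j × y ≡ i + j * T)
latticeCoordinates {N} {T} N≡T²-1 (k , p , q , refl , refl) =
  k + T * p - q , T * q - p , firstCoordinate , secondCoordinate
  where
  firstIdentity : ∀ T k p q →
    k * T + p * (T * T - 1ℤ) ≡ (k + T * p - q) * T + (T * q - p)
  firstIdentity = solve-∀
  secondIdentity : ∀ T k p q →
    k * 1ℤ + q * (T * T - 1ℤ) ≡ (k + T * p - q) + (T * q - p) * T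
  secondIdentity = solve-∀
  firstCoordinate : k * T + p * + N ≡ (k + T * p - q) * T + (T * q - p)
  firstCoordinate = trans (cong (λ n → k * T + p * n) N≡T²-1) (firstIdentity T k p q)
  secondCoordinate : k * 1ℤ + q * + N ≡ (k + T * p - q) + (T * q - p) * T
  secondCoordinate = trans (cong (λ n → k * 1ℤ + q * n) N≡T²-1) (secondIdentity T k p q)

normInCoordinates : ∀ U i j →
  normSq (i * (1ℤ + U) + j) (i + j * (1ℤ + U))
    ≡ U * U * (i * i + j * j) + + 2 * (1ℤ + U) * ((i + j) * (i + j))
normInCoordinates U i j = expanded U i j
  where
  expanded : ∀ U i j →
    (i * (1ℤ + U) + j) * (i * (1ℤ + U) + j) + (i + j * (1ℤ + U)) * (i + j * (1ℤ + U))
      ≡ U * U * (i * i + j * j) + + 2 * (1ℤ + U) * ((i + j) * (i + j))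
  expanded = solve-∀

square≡ : ∀ i → i * i ≡ + (∣ i ∣ ℕ.* ∣ i ∣)
square≡ (+ n)    = sym (ℤP.pos-* n n)
square≡ -[1+ n ] = refl

castForm : ∀ u q w →
  + u * + u * + q + + 2 * (1ℤ + + u) * + w
    ≡ + (u ℕ.* u ℕ.* q ℕ.+ 2 ℕ.* (1 ℕ.+ u) ℕ.* w)
castForm u q w = sym (begin
  + (u ℕ.* u ℕ.* q ℕ.+ 2 ℕ.* (1 ℕ.+ u) ℕ.* w)
    ≡⟨ cong₂ _+_ (ℤP.pos-* (u ℕ.* u) q) (ℤP.pos-* (2 ℕ.* (1 ℕ.+ u)) w) ⟩
  + (u ℕ.* u) * + q + + (2 ℕ.* (1 ℕ.+ u)) * + w
    ≡⟨ cong₂ (λ uu tt → uu * + q + tt * + w) (ℤP.pos-* u u) (ℤP.pos-* 2 (1 ℕ.+ u)) ⟩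
  + u * + u * + q + + 2 * (1ℤ + + u) * + w ∎)

normAsNatural : ∀ u i j →
  normSq (i * (1ℤ + + u) + j) (i + j * (1ℤ + + u))
    ≡ + (u ℕ.* u ℕ.* (∣ i ∣ ℕ.* ∣ i ∣ ℕ.+ ∣ j ∣ ℕ.* ∣ j ∣)
         ℕ.+ 2 ℕ.* (1 ℕ.+ u) ℕ.* (∣ i + j ∣ ℕ.* ∣ i + j ∣))
normAsNatural u i j = begin
  normSq (i * (1ℤ + + u) + j) (i + j * (1ℤ + + u))
    ≡⟨ normInCoordinates (+ u) i j ⟩
  + u * + u * (i * i + j * j) + + 2 * (1ℤ + + u) * ((i + j) * (i + j))
    ≡⟨ cong₂ (λ S W → + u * + u * S + + 2 * (1ℤ + + u) * W)
             (cong₂ _+_ (square≡ i) (square≡ j)) (square≡ (i + j)) ⟩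
  + u * + u * + (∣ i ∣ ℕ.* ∣ i ∣ ℕ.+ ∣ j ∣ ℕ.* ∣ j ∣)
    + + 2 * (1ℤ + + u) * + (∣ i + j ∣ ℕ.* ∣ i + j ∣)
    ≡⟨ castForm u _ _ ⟩
  _ ∎

axisSquares : ∀ i j → ∣ i ∣ ℕ.* ∣ j ∣ ≡ 0 →
  ∣ i + j ∣ ℕ.* ∣ i + j ∣ ≡ ∣ i ∣ ℕ.* ∣ i ∣ ℕ.+ ∣ j ∣ ℕ.* ∣ j ∣
axisSquares i j ∣i∣∣j∣≡0 = ℤP.+-injective (begin
  + (∣ i + j ∣ ℕ.* ∣ i + j ∣)     ≡⟨ sym (square≡ (i + j)) ⟩
  (i + j) * (i + j)               ≡⟨ binomial i j ⟩
  i * i + j * j + + 2 * (i * j)   ≡⟨ cong (λ z → i * i + j * j + + 2 * z) ij≡0 ⟩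
  i * i + j * j + + 2 * 0ℤ        ≡⟨ ℤP.+-identityʳ (i * i + j * j) ⟩
  i * i + j * j                   ≡⟨ cong₂ _+_ (square≡ i) (square≡ j) ⟩
  + (∣ i ∣ ℕ.* ∣ i ∣ ℕ.+ ∣ j ∣ ℕ.* ∣ j ∣) ∎)
  where
  binomial : ∀ i j → (i + j) * (i + j) ≡ i * i + j * j + + 2 * (i * j)
  binomial = solve-∀
  ij≡0 : i * j ≡ 0ℤ
  ij≡0 = ℤP.∣i∣≡0⇒i≡0 (trans (ℤP.abs-* i j) ∣i∣∣j∣≡0)

modulus : ℕ → ℕ
modulus s = (3 ℕ.+ s) ℕ.* (5 ℕ.+ s)

modulus≡T²-1 : ∀ s → + modulus s ≡ + (4 ℕ.+ s) * + (4 ℕ.+ s) - 1ℤ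
modulus≡T²-1 s = trans (ℤP.pos-* (3 ℕ.+ s) (5 ℕ.+ s)) (difference (+ (3 ℕ.+ s)))
  where
  difference : ∀ U → U * (+ 2 + U) ≡ (1ℤ + U) * (1ℤ + U) - 1ℤ
  difference = solve-∀

axisBound : ∀ s q → 1 ≤ q →
  modulus s < (3 ℕ.+ s) ℕ.* (3 ℕ.+ s) ℕ.* q ℕ.+ 2 ℕ.* (4 ℕ.+ s) ℕ.* q
axisBound s q 1≤q = ℕP.<-≤-trans N<form₁ (ℕP.+-mono-≤ (ℕP.*-monoʳ-≤ ((3 ℕ.+ s) ℕ.* (3 ℕ.+ s)) 1≤q)
                                           (ℕP.*-monoʳ-≤ (2 ℕ.* (4 ℕ.+ s)) 1≤q))
  where
  excess : ∀ s → (3 ℕ.+ s) ℕ.* (3 ℕ.+ s) ℕ.* 1 ℕ.+ 2 ℕ.* (4 ℕ.+ s) ℕ.* 1 ≡ (3 ℕ.+ s) ℕ.* (5 ℕ.+ s) ℕ.+ 2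
  excess = ℕSolver.solve-∀
  N<form₁ : modulus s < (3 ℕ.+ s) ℕ.* (3 ℕ.+ s) ℕ.* 1 ℕ.+ 2 ℕ.* (4 ℕ.+ s) ℕ.* 1
  N<form₁ = subst (modulus s <_) (sym (excess s)) (ℕP.m<m+n (modulus s) (s≤s z≤n))

offAxisBound : ∀ s q w → 2 ≤ q →
  modulus s < (3 ℕ.+ s) ℕ.* (3 ℕ.+ s) ℕ.* q ℕ.+ 2 ℕ.* (4 ℕ.+ s) ℕ.* w
offAxisBound s q w 2≤q =
  ℕP.<-≤-trans N<2u² (ℕP.≤-trans (ℕP.*-monoʳ-≤ ((3 ℕ.+ s) ℕ.* (3 ℕ.+ s)) 2≤q)
                         (ℕP.m≤m+n _ (2 ℕ.* (4 ℕ.+ s) ℕ.* w)))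
  where
  excess : ∀ s → (3 ℕ.+ s) ℕ.* (3 ℕ.+ s) ℕ.* 2 ≡ (3 ℕ.+ s) ℕ.* (5 ℕ.+ s) ℕ.+ suc (s ℕ.* s ℕ.+ 4 ℕ.* s ℕ.+ 2)
  excess = ℕSolver.solve-∀
  N<2u² : modulus s < (3 ℕ.+ s) ℕ.* (3 ℕ.+ s) ℕ.* 2
  N<2u² = subst (modulus s <_) (sym (excess s)) (ℕP.m<m+n (modulus s) (s≤s z≤n))

-- The quadratic form exceeds N at every non-zero point (a, b) = (|i|, |j|),
-- where w = |i + j|² equals a² + b² whenever ab = 0.
formBound : ∀ s a b w → ¬ (a ≡ 0 × b ≡ 0) → (a ℕ.* b ≡ 0 → w ≡ a ℕ.* a ℕ.+ b ℕ.* b) →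
  modulus s < (3 ℕ.+ s) ℕ.* (3 ℕ.+ s) ℕ.* (a ℕ.* a ℕ.+ b ℕ.* b) ℕ.+ 2 ℕ.* (4 ℕ.+ s) ℕ.* w
formBound s zero    zero    w nonzero axis = contradiction (refl , refl) nonzero
formBound s zero    (suc n) w nonzero axis rewrite axis refl =
  axisBound s (suc n ℕ.* suc n) (s≤s z≤n)
formBound s (suc m) zero    w nonzero axis rewrite axis (ℕP.*-zeroʳ m) =
  axisBound s (suc m ℕ.* suc m ℕ.+ 0) (s≤s z≤n)
formBound s (suc m) (suc n) w nonzero axis =
  offAxisBound s _ w (ℕP.+-mono-≤ {1} {suc m ℕ.* suc m} {1} (s≤s z≤n) (s≤s z≤n))

latticeBound : ∀ s → fGreaterOne (modulus s) (+ (4 ℕ.+ s)) 1ℤ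
latticeBound s x y inLattice nonzero
  with latticeCoordinates (modulus≡T²-1 s) inLattice
... | i , j , refl , refl =
  subst (+ modulus s ℤ.<_) (sym (normAsNatural (3 ℕ.+ s) i j))
    (ℤ.+<+ (formBound s ∣ i ∣ ∣ j ∣ _ coordinatesNonzero (axisSquares i j)))
  where
  coordinatesNonzero : ¬ (∣ i ∣ ≡ 0 × ∣ j ∣ ≡ 0)
  coordinatesNonzero (∣i∣≡0 , ∣j∣≡0) =
    nonzero (originVector {i} {j} (ℤP.∣i∣≡0⇒i≡0 ∣i∣≡0) (ℤP.∣i∣≡0⇒i≡0 ∣j∣≡0))
    where
    originVector : ∀ {i j} → i ≡ 0ℤ → j ≡ 0ℤ →
      i * + (4 ℕ.+ s) + j ≡ 0ℤ × i + j * + (4 ℕ.+ s) ≡ 0ℤ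
    originVector refl refl = refl , refl

T<modulus : ∀ s → 4 ℕ.+ s < modulus s
T<modulus s = subst (4 ℕ.+ s <_) (sym (excess s)) (ℕP.m<m+n (4 ℕ.+ s) (s≤s z≤n))
  where
  excess : ∀ s → (3 ℕ.+ s) ℕ.* (5 ℕ.+ s) ≡ (4 ℕ.+ s) ℕ.+ suc (s ℕ.* s ℕ.+ 7 ℕ.* s ℕ.+ 10)
  excess = ℕSolver.solve-∀

theorem1p4 : ∀ (M : ℕ) → ∃[ N ] (M < N × ∃[ a ] ∃[ b ]
    ((0 < a × a < N) × (0 < b × b < N) × fGreaterOne N (+ a) (+ b)))
theorem1p4 M =
  modulus M , ℕP.<-trans M<T (T<modulus M) , 4 ℕ.+ M , 1 ,
  (s≤s z≤n , T<modulus M) ,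
  (s≤s z≤n , ℕP.<-trans (s≤s (s≤s z≤n)) (T<modulus M)) ,
  latticeBound M
  where
  M<T : M < 4 ℕ.+ M
  M<T = ℕP.m<n+m M (s≤s z≤n)
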